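{- Let $k\ge 1$ be an integer and $M=2^{k+1}-1$. Let $a$ be an integer with $M<a<M(M+1)$, and let $d<e$ be positive integers with $de=\frac{M(M+1)-a}{4}$. Put $p=M+2d$ and $q=M+2e$. Suppose $p$ and $q$ are both prime, and that $pq\neq r+sp+tq$ for all integers $r,s,t$ with $1\le r\le M$, $1\le s\le M$, $1\le t\le M$. Then $2^kpq$ is weird.
   Context: $\sigma(n)$ denotes the sum of all positive divisors of $n$. A natural number $n$ is abundant if $\sigma(n)>2n$. The aliquot parts of $n$ are the positive divisors $d$ of $n$ with $d<n$. An abundant number $n$ is pseudoperfect if $n$ equals the sum of the elements of some subset of the aliquot parts of $n$ (each aliquot part used at most once). A natural number $n$ is weird if it is abundant but not pseudoperfect. -}

module Defs where

open import Data.Nat using (ℕ; suc; _+_; _*_; _<_; _<?_)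
open import Data.Nat.Divisibility using (_∣_; _∣?_)
open import Data.List using (List; filter; map; upTo)
open import Data.Nat.ListAction using (sum)
open import Data.List.Relation.Binary.Sublist.Propositional using (_⊆_)
open import Data.Product using (Σ; _×_)
open import Relation.Binary.PropositionalEquality using (_≡_)
open import Relation.Nullary using (¬_)

divisors : ℕ → List ℕ
divisors n = filter (_∣? n) (map suc (upTo n))

aliquotParts : ℕ → List ℕ
aliquotParts n = filter (_∣? n) (filter (_<? n) (map suc (upTo n)))

σ : ℕ → ℕ
σ n = sum (divisors n)

Abundant : ℕ → Set
Abundant n = 2 * n < σ n

-- n is the sum of some subset of its aliquot parts (each used at most once):
-- a sublist of the (duplicate-free) list of aliquot parts
Pseudoperfect : ℕ → Set
Pseudoperfect n = Abundant n × Σ (List ℕ) (λ xs → (xs ⊆ aliquotParts n) × (sum xs ≡ n))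

Weird : ℕ → Set
Weird n = Abundant n × ¬ Pseudoperfect n

module Submission where

-- Every
-- divisor of n is c·2^i with c ∈ {pq, p, q, 1} and i ≤ k, so the divisors
-- fall into four classes according to which of p, q divide them.
--
-- Each class contains all of c·2^0, …, c·2^k, whose sum is
--   c·M; hence σ(n) ≥ M(pq + p + q + 1), which exceeds 2n = (M+1)pq as soon
--   as pq < M(p + q + 1).
-- * No subset sum.  A set of distinct aliquot parts splits along the same
--   classes; a set of distinct numbers c·2^i (i < j) sums to A·c with
--   A < 2^j.  A subset summing to n would thus give
--   2^k·pq = A·pq + (r + s·p + t·q) with A < 2^k and r, s, t ≤ M.  As
--   r + s·p + t·q < 2pq this forces r + s·p + t·q = pq, which is impossible
--   for s = 0, t = 0 or r = 0 by size and divisibility, and is excluded by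
--   hypothesis otherwise.

open import Defs
open import Data.Nat using (ℕ; zero; suc; _+_; _*_; _^_; _∸_; _<_; _≤_; z≤n; s≤s; s≤s⁻¹; NonZero; >-nonZero⁻¹; _<?_)
open import Data.Nat.Properties
open import Data.Nat.Divisibility
open import Data.Nat.Primality using (Prime; prime⇒irreducible; prime⇒nonZero; euclidsLemma; ¬prime[1]; prime[2])
open import Data.Nat.Coprimality using (Coprime; coprime-divisor)
open import Data.Nat.ListAction using (sum)
open import Data.Nat.Tactic.RingSolver using (solve-∀)
open import Data.List using (List; []; _∷_; filter; map; upTo)
open import Data.List.Relation.Unary.All using (All; []; _∷_)
import Data.List.Relation.Unary.All as All
open import Data.List.Relation.Unary.Any using (here; there; _─_)
open import Data.List.Membership.Propositional using (_∈_)
open import Data.List.Membership.Propositional.Properties using (∈-filter⁺; ∈-filter⁻; ∈-map⁺; ∈-upTo⁺)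
open import Data.List.Relation.Unary.Unique.Propositional using (Unique)
open import Data.List.Relation.Unary.AllPairs using ([]; _∷_)
open import Data.List.Relation.Unary.Unique.Propositional.Properties using (filter⁺; map⁺; upTo⁺)
open import Data.List.Relation.Binary.Sublist.Propositional using (_⊆_; []; _∷_; _∷ʳ_)
open import Data.List.Relation.Binary.Sublist.Propositional.Properties using (All-resp-⊆; Any-resp-⊆)
open import Data.Product using (_×_; ∃-syntax; _,_; proj₁; proj₂)
open import Data.Sum using (inj₁; inj₂)
open import Data.Empty using (⊥-elim)
open import Level using (0ℓ)
open import Relation.Nullary using (¬_; ¬?; yes; no)
open import Relation.Unary using (Pred; Decidable)
open import Relation.Binary.PropositionalEquality using (_≡_; _≢_; refl; sym; ≢-sym; trans; cong; cong₂; subst; module ≡-Reasoning)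

sum-─ : ∀ {y : ℕ} xs (y∈xs : y ∈ xs) → sum xs ≡ y + sum (xs ─ y∈xs)
sum-─ (x ∷ xs) (here refl) = refl
sum-─ {y} (x ∷ xs) (there y∈xs) = begin
  x + sum xs                  ≡⟨ cong (x +_) (sum-─ xs y∈xs) ⟩
  x + (y + sum (xs ─ y∈xs))   ≡⟨ +-comm x _ ⟩
  (y + sum (xs ─ y∈xs)) + x   ≡⟨ +-assoc y _ x ⟩
  y + (sum (xs ─ y∈xs) + x)   ≡⟨ cong (y +_) (+-comm _ x) ⟩
  y + (x + sum (xs ─ y∈xs))   ∎
  where open ≡-Reasoning

∈-─ : ∀ {y z : ℕ} xs (y∈xs : y ∈ xs) → z ∈ xs → y ≢ z → z ∈ (xs ─ y∈xs)
∈-─ (x ∷ xs) (here refl) (here refl)  y≢z = ⊥-elim (y≢z refl)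
∈-─ (x ∷ xs) (here refl) (there z∈xs) y≢z = z∈xs
∈-─ (x ∷ xs) (there y∈xs) (here refl) y≢z = here refl
∈-─ (x ∷ xs) (there y∈xs) (there z∈xs) y≢z = there (∈-─ xs y∈xs z∈xs y≢z)

sum-distinct-≤ : ∀ {ys : List ℕ} xs → Unique ys → All (_∈ xs) ys → sum ys ≤ sum xs
sum-distinct-≤ xs [] [] = z≤n
sum-distinct-≤ {y ∷ ys} xs (y∉ys ∷ ys-unique) (y∈xs ∷ ys⊆xs) =
  subst (y + sum ys ≤_) (sym (sum-─ xs y∈xs))
    (+-monoʳ-≤ y (sum-distinct-≤ (xs ─ y∈xs) ys-unique
      (All.zipWith (λ (y≢z , z∈xs) → ∈-─ xs y∈xs z∈xs y≢z) (y∉ys , ys⊆xs))))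

Unique-⊆ : ∀ {xs ys : List ℕ} → xs ⊆ ys → Unique ys → Unique xs
Unique-⊆ [] [] = []
Unique-⊆ (y ∷ʳ xs⊆ys) (_ ∷ ys-unique) = Unique-⊆ xs⊆ys ys-unique
Unique-⊆ (refl ∷ xs⊆ys) (y∉ys ∷ ys-unique) = All-resp-⊆ xs⊆ys y∉ys ∷ Unique-⊆ xs⊆ys ys-unique

sum-filter : ∀ {A : Pred ℕ 0ℓ} (A? : Decidable A) xs →
  sum xs ≡ sum (filter A? xs) + sum (filter (λ x → ¬? (A? x)) xs)
sum-filter A? [] = refl
sum-filter A? (x ∷ xs) with A? x
... | yes _ = trans (cong (x +_) (sum-filter A? xs)) (sym (+-assoc x _ _))
... | no  _ = trans (cong (x +_) (sum-filter A? xs)) (exchange x (sum (filter A? xs)) _)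
  where
  exchange : ∀ a b c → a + (b + c) ≡ b + (a + c)
  exchange = solve-∀

∈-filter²⁺ : ∀ {A B : Pred ℕ 0ℓ} (A? : Decidable A) (B? : Decidable B) {x xs} →
  x ∈ xs → A x → B x → x ∈ filter B? (filter A? xs)
∈-filter²⁺ A? B? x∈xs a b = ∈-filter⁺ B? (∈-filter⁺ A? x∈xs a) b

∈-filter²⁻ : ∀ {A B : Pred ℕ 0ℓ} (A? : Decidable A) (B? : Decidable B) {x xs} →
  x ∈ filter B? (filter A? xs) → x ∈ xs × A x × B x
∈-filter²⁻ A? B? x∈ with ∈-filter⁻ B? x∈
... | x∈′ , b with ∈-filter⁻ A? x∈′
... | x∈xs , a = x∈xs , a , b

∣-sum : ∀ {c} xs → All (c ∣_) xs → c ∣ sum xs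
∣-sum [] [] = _ ∣0
∣-sum (x ∷ xs) (c∣x ∷ c∣xs) = ∣m∣n⇒∣m+n c∣x (∣-sum xs c∣xs)

prime-cancel : ∀ {p x y} → Prime p → ¬ p ∣ x → x ∣ p * y → x ∣ y
prime-cancel {p} {x} pp p∤x x∣py = coprime-divisor x⊥p x∣py
  where
  x⊥p : Coprime x p
  x⊥p (d∣x , d∣p) with prime⇒irreducible pp d∣p
  ... | inj₁ d≡1 = d≡1
  ... | inj₂ refl = ⊥-elim (p∤x d∣x)

prime∤* : ∀ {p a b} → Prime p → ¬ p ∣ a → ¬ p ∣ b → ¬ p ∣ a * b
prime∤* {a = a} {b} pp p∤a p∤b p∣ab with euclidsLemma a b pp p∣ab
... | inj₁ p∣a = p∤a p∣a
... | inj₂ p∣b = p∤b p∣b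

∣p^k⇒≡p^i : ∀ {p x} k → Prime p → x ∣ p ^ k → ∃[ i ] i ≤ k × x ≡ p ^ i
∣p^k⇒≡p^i zero pp x∣1 = 0 , z≤n , ∣1⇒≡1 x∣1
∣p^k⇒≡p^i {p} {x} (suc k) pp x∣p^k+1 with p ∣? x
... | yes (divides z refl) =
  let instance _ = prime⇒nonZero pp
      i , i≤k , z≡p^i = ∣p^k⇒≡p^i k pp (*-cancelʳ-∣ {m = z} p (subst (z * p ∣_) (*-comm p (p ^ k)) x∣p^k+1))
  in suc i , s≤s i≤k , trans (cong (_* p) z≡p^i) (*-comm (p ^ i) p)
... | no p∤x =
  let i , i≤k , x≡p^i = ∣p^k⇒≡p^i k pp (prime-cancel pp p∤x x∣p^k+1)
  in i , m≤n⇒m≤1+n i≤k , x≡p^i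

^-∣ : ∀ m {i k} → i ≤ k → m ^ i ∣ m ^ k
^-∣ m {i} i≤k with m≤n⇒∃[o]m+o≡n i≤k
... | o , refl = divides (m ^ o) (trans (^-distribˡ-+-* m i o) (*-comm (m ^ i) (m ^ o)))

prime∤1 : ∀ {p} → Prime p → ¬ p ∣ 1
prime∤1 pp p∣1 = ¬prime[1] (subst Prime (∣1⇒≡1 p∣1) pp)

prime∤prime : ∀ {p q} → Prime p → Prime q → p ≢ q → ¬ p ∣ q
prime∤prime pp pq p≢q p∣q with prime⇒irreducible pq p∣q
... | inj₁ refl = ¬prime[1] pp
... | inj₂ p≡q = p≢q p≡q

prime∤prime^ : ∀ {p q} i → Prime p → Prime q → p ≢ q → ¬ p ∣ q ^ i
prime∤prime^ {q = q} i pp pq p≢q p∣q^i with ∣p^k⇒≡p^i i pq p∣q^i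
... | zero  , _ , refl = ¬prime[1] pp
... | suc j , _ , refl = prime∤prime pq pp (≢-sym p≢q) (m∣m*n (q ^ j))

prime*prime∣ : ∀ {p q x} → Prime p → Prime q → p ≢ q → p ∣ x → q ∣ x → p * q ∣ x
prime*prime∣ {p} {q} pp pq p≢q (divides z refl) q∣zp with euclidsLemma z p pq q∣zp
... | inj₂ q∣p = ⊥-elim (prime∤prime pq pp (≢-sym p≢q) q∣p)
... | inj₁ (divides w refl) = divides w (rearrange w q p)
  where
  rearrange : ∀ w q p → w * q * p ≡ w * (p * q)
  rearrange = solve-∀

doublings : ℕ → ℕ → List ℕ
doublings c zero    = []
doublings c (suc j) = c * 2 ^ j ∷ doublings c j

doublings-sum : ∀ c j → c + sum (doublings c j) ≡ c * 2 ^ j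
doublings-sum c zero    = trans (+-identityʳ c) (sym (*-identityʳ c))
doublings-sum c (suc j) = begin
  c + (c * 2 ^ j + sum (doublings c j))  ≡⟨ exchange c (c * 2 ^ j) _ ⟩
  c * 2 ^ j + (c + sum (doublings c j))  ≡⟨ cong (c * 2 ^ j +_) (doublings-sum c j) ⟩
  c * 2 ^ j + c * 2 ^ j                  ≡⟨ double c (2 ^ j) ⟩
  c * 2 ^ suc j                          ∎
  where
  open ≡-Reasoning
  exchange : ∀ a b s → a + (b + s) ≡ b + (a + s)
  exchange = solve-∀
  double : ∀ c x → c * x + c * x ≡ c * (2 * x)
  double = solve-∀

∈-doublings : ∀ c {i} j → i < j → c * 2 ^ i ∈ doublings c j
∈-doublings c (suc j) i<1+j with m≤n⇒m<n∨m≡n (s≤s⁻¹ i<1+j)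
... | inj₁ i<j  = there (∈-doublings c j i<j)
... | inj₂ refl = here refl

doublings-< : ∀ c .{{_ : NonZero c}} j → All (_< c * 2 ^ j) (doublings c j)
doublings-< c zero    = []
doublings-< c (suc j) =
  c*2^j<c*2^j+1 ∷ All.map (λ x<c*2^j → <-trans x<c*2^j c*2^j<c*2^j+1) (doublings-< c j)
  where
  c*2^j<c*2^j+1 : c * 2 ^ j < c * 2 ^ suc j
  c*2^j<c*2^j+1 = *-monoʳ-< c (^-monoʳ-< 2 (s≤s (s≤s z≤n)) (n<1+n j))

doublings-unique : ∀ c .{{_ : NonZero c}} j → Unique (doublings c j)
doublings-unique c zero    = []
doublings-unique c (suc j) = All.map >⇒≢ (doublings-< c j) ∷ doublings-unique c j

DoublingOf : ℕ → ℕ → ℕ → Set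
DoublingOf c j x = ∃[ i ] i < j × x ≡ c * 2 ^ i

distinct-doublings-sum : ∀ c .{{_ : NonZero c}} j {ys} → Unique ys →
  All (DoublingOf c j) ys → ∃[ A ] sum ys ≡ A * c × A < 2 ^ j
distinct-doublings-sum c j {ys} ys-unique shapes
  with ∣-sum ys (All.map (λ { (i , _ , refl) → m∣m*n (2 ^ i) }) shapes)
... | divides A sum≡A*c = A , sum≡A*c , *-cancelʳ-≤ (suc A) (2 ^ j) c (begin
  c + A * c                   ≡⟨ cong (c +_) sum≡A*c ⟨
  c + sum ys                  ≤⟨ +-monoʳ-≤ c (sum-distinct-≤ (doublings c j) ys-unique
                                   (All.map (λ { (i , i<j , refl) → ∈-doublings c j i<j }) shapes)) ⟩
  c + sum (doublings c j)     ≡⟨ doublings-sum c j ⟩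
  c * 2 ^ j                   ≡⟨ *-comm c (2 ^ j) ⟩
  2 ^ j * c                   ∎)
  where open ≤-Reasoning

doublings-below : ∀ c .{{_ : NonZero c}} j L → (∀ i → i < j → c * 2 ^ i ∈ L) →
  c * 2 ^ j ≤ c + sum L
doublings-below c j L contains = begin
  c * 2 ^ j                ≡⟨ doublings-sum c j ⟨
  c + sum (doublings c j)  ≤⟨ +-monoʳ-≤ c (sum-distinct-≤ L (doublings-unique c j) (all-in j ≤-refl)) ⟩
  c + sum L                ∎
  where
  open ≤-Reasoning
  all-in : ∀ j′ → j′ ≤ j → All (_∈ L) (doublings c j′)
  all-in zero    _      = []
  all-in (suc j′) j′<j = contains j′ j′<j ∷ all-in j′ (<⇒≤ j′<j)

≢-mul-add : ∀ {a b c d} → c < a → d < b → a * b ≢ c * b + d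
≢-mul-add {a} {b} {c} {d} c<a d<b ab≡cb+d = <⇒≱ d<b (+-cancelˡ-≤ (c * b) b d (begin
  c * b + b  ≡⟨ +-comm (c * b) b ⟩
  suc c * b  ≤⟨ *-monoˡ-≤ b c<a ⟩
  a * b      ≡⟨ ab≡cb+d ⟩
  c * b + d  ∎))
  where open ≤-Reasoning

remainder-≡ : ∀ {A x m R} → A < x → x * m ≡ A * m + R → R < m + m → R ≡ m
remainder-≡ {A} {x} {m} {R} A<x xm≡Am+R R<2m with m≤n⇒∃[o]m+o≡n A<x
... | o , refl with +-cancelˡ-≡ (A * m) _ _ (trans (sym (expand A o m)) xm≡Am+R)
  where
  expand : ∀ A o m → (suc A + o) * m ≡ A * m + (m + o * m)
  expand = solve-∀
... | m+om≡R with o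
...   | zero   = trans (sym m+om≡R) (+-identityʳ m)
...   | suc o′ = ⊥-elim (<⇒≱ R<2m (begin
  m + m               ≤⟨ +-monoʳ-≤ m (m≤m+n m (o′ * m)) ⟩
  m + (m + o′ * m)    ≡⟨ m+om≡R ⟩
  R                   ∎))
  where open ≤-Reasoning

combination-< : ∀ {M P Q r s t} → M < P → P < Q → r ≤ M → s ≤ M → t ≤ M →
  r + s * P + t * Q < P * Q + P * Q
combination-< {M} {P} {Q} {r} {s} {t} M<P P<Q r≤M s≤M t≤M = begin-strict
  r + s * P + t * Q          ≤⟨ +-mono-≤ (+-mono-≤ r≤M (*-monoˡ-≤ P s≤M)) (*-monoˡ-≤ Q t≤M) ⟩
  M + M * P + M * Q          <⟨ +-monoˡ-< (M * Q) (+-monoˡ-< (M * P) M<P) ⟩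
  P + M * P + M * Q          ≤⟨ m≤m+n _ Q ⟩
  P + M * P + M * Q + Q      ≡⟨ regroup M P Q ⟩
  suc M * Q + P * suc M      ≤⟨ +-mono-≤ (*-monoˡ-≤ Q M<P) (*-monoʳ-≤ P (<-trans M<P P<Q)) ⟩
  P * Q + P * Q              ∎
  where
  open ≤-Reasoning
  regroup : ∀ M P Q → P + M * P + M * Q + Q ≡ suc M * Q + P * suc M
  regroup = solve-∀

NoSmallRepresentation : ℕ → ℕ → ℕ → Set
NoSmallRepresentation M P Q = (r s t : ℕ) → 1 ≤ r → r ≤ M → 1 ≤ s → s ≤ M → 1 ≤ t → t ≤ M →
  P * Q ≢ r + s * P + t * Q

-- The hypothesis extends to coefficients 0 ≤ r, s, t ≤ M: a zero coefficient
-- is ruled out by division with remainder (s = 0 or t = 0) or by p ∤ q (r = 0).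
combination-≢ : ∀ {M P Q} → Prime P → Prime Q → M < P → P < Q → NoSmallRepresentation M P Q →
  ∀ r s t → r ≤ M → s ≤ M → t ≤ M → P * Q ≢ r + s * P + t * Q
combination-≢ {M} {P} {Q} _ _ M<P P<Q _ r zero t r≤M _ t≤M pq≡ =
  ≢-mul-add (≤-<-trans t≤M M<P) (<-trans (≤-<-trans r≤M M<P) P<Q)
    (trans pq≡ (drop-s r t Q))
  where
  drop-s : ∀ r t Q → r + 0 + t * Q ≡ t * Q + r
  drop-s = solve-∀
combination-≢ {M} {P} {Q} _ _ M<P P<Q _ r (suc s) zero r≤M s≤M _ pq≡ =
  ≢-mul-add (<-trans (≤-<-trans s≤M M<P) P<Q) (≤-<-trans r≤M M<P)
    (trans (*-comm Q P) (trans pq≡ (drop-t r (suc s) P)))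
  where
  drop-t : ∀ r s P → r + s * P + 0 ≡ s * P + r
  drop-t = solve-∀
combination-≢ {M} {P} {Q} prime-P prime-Q M<P P<Q _ zero (suc s) (suc t) _ _ t≤M pq≡
  with euclidsLemma (suc t) Q prime-P
         (∣m+n∣m⇒∣n (subst (P ∣_) pq≡ (m∣m*n Q)) (n∣m*n (suc s)))
... | inj₁ P∣t = <⇒≱ (≤-<-trans t≤M M<P) (∣⇒≤ P∣t)
... | inj₂ P∣Q = prime∤prime prime-P prime-Q (<⇒≢ P<Q) P∣Q
combination-≢ _ _ _ _ no-rep (suc r) (suc s) (suc t) r≤M s≤M t≤M =
  no-rep (suc r) (suc s) (suc t) (s≤s z≤n) r≤M (s≤s z≤n) s≤M (s≤s z≤n) t≤M

∈-divisors : ∀ {m x} .{{_ : NonZero m}} → 0 < x → x ∣ m → x ∈ divisors m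
∈-divisors {m} {suc x} _ x∣m = ∈-filter⁺ (_∣? m) (∈-map⁺ suc (∈-upTo⁺ (∣⇒≤ x∣m))) x∣m

aliquotParts-unique : ∀ m → Unique (aliquotParts m)
aliquotParts-unique m = filter⁺ (_∣? m) (filter⁺ (_<? m) (map⁺ suc-injective (upTo⁺ m)))

∈-aliquotParts⁻ : ∀ {m x} → x ∈ aliquotParts m → x ∣ m × x < m
∈-aliquotParts⁻ {m} x∈ with ∈-filter⁻ (_∣? m) x∈
... | x∈′ , x∣m = x∣m , proj₂ (∈-filter⁻ (_<? m) {xs = map suc (upTo m)} x∈′)

multiple∣c*2^k : ∀ c .{{_ : NonZero c}} k {x} → c ∣ x → x ∣ c * 2 ^ k →
  ∃[ i ] i ≤ k × x ≡ c * 2 ^ i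
multiple∣c*2^k c k (divides z refl) zc∣c2^k
  with ∣p^k⇒≡p^i k prime[2] (*-cancelˡ-∣ c (subst (_∣ c * 2 ^ k) (*-comm z c) zc∣c2^k))
... | i , i≤k , refl = i , i≤k , *-comm (2 ^ i) c

module TwoPowerTimesTwoPrimes (k M P Q : ℕ) (M+1≡2^[k+1] : M + 1 ≡ 2 ^ suc k)
  (prime-P : Prime P) (prime-Q : Prime Q) (2<P : 2 < P) (P<Q : P < Q) where

  instance
    P≢0 : NonZero P
    P≢0 = prime⇒nonZero prime-P
    Q≢0 : NonZero Q
    Q≢0 = prime⇒nonZero prime-Q
    PQ≢0 : NonZero (P * Q)
    PQ≢0 = m*n≢0 P Q
    n≢0 : NonZero (2 ^ k * (P * Q))
    n≢0 = m*n≢0 (2 ^ k) (P * Q) {{m^n≢0 2 k}}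

  n : ℕ
  n = 2 ^ k * (P * Q)

  P≢Q : P ≢ Q
  P≢Q = <⇒≢ P<Q

  P∤2^ : ∀ i → ¬ P ∣ 2 ^ i
  P∤2^ i = prime∤prime^ i prime-P prime[2] (>⇒≢ 2<P)

  Q∤2^ : ∀ i → ¬ Q ∣ 2 ^ i
  Q∤2^ i = prime∤prime^ i prime-Q prime[2] (>⇒≢ (<-trans 2<P P<Q))

  P∤? : Decidable (λ x → ¬ P ∣ x)
  P∤? x = ¬? (P ∣? x)

  Q∤? : Decidable (λ x → ¬ Q ∣ x)
  Q∤? x = ¬? (Q ∣? x)

  byPQ byP byQ by1 : List ℕ → List ℕ
  byPQ L = filter (Q ∣?_) (filter (P ∣?_) L)
  byP  L = filter Q∤?     (filter (P ∣?_) L)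
  byQ  L = filter (Q ∣?_) (filter P∤? L)
  by1  L = filter Q∤?     (filter P∤? L)

  sum-classes : ∀ L → sum L ≡ (sum (byPQ L) + sum (byP L)) + (sum (byQ L) + sum (by1 L))
  sum-classes L = trans (sum-filter (P ∣?_) L)
    (cong₂ _+_ (sum-filter (Q ∣?_) (filter (P ∣?_) L)) (sum-filter (Q ∣?_) (filter P∤? L)))

  shape-PQ : ∀ {x} → x ∣ n → P ∣ x → Q ∣ x → ∃[ i ] i ≤ k × x ≡ (P * Q) * 2 ^ i
  shape-PQ {x} x∣n P∣x Q∣x = multiple∣c*2^k (P * Q) k (prime*prime∣ prime-P prime-Q P≢Q P∣x Q∣x)
    (subst (x ∣_) (*-comm (2 ^ k) (P * Q)) x∣n)

  shape-P : ∀ {x} → x ∣ n → P ∣ x → ¬ Q ∣ x → ∃[ i ] i ≤ k × x ≡ P * 2 ^ i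
  shape-P {x} x∣n P∣x Q∤x = multiple∣c*2^k P k P∣x
    (prime-cancel prime-Q Q∤x (subst (x ∣_) (regroup (2 ^ k) P Q) x∣n))
    where
    regroup : ∀ a P Q → a * (P * Q) ≡ Q * (P * a)
    regroup = solve-∀

  shape-Q : ∀ {x} → x ∣ n → ¬ P ∣ x → Q ∣ x → ∃[ i ] i ≤ k × x ≡ Q * 2 ^ i
  shape-Q {x} x∣n P∤x Q∣x = multiple∣c*2^k Q k Q∣x
    (prime-cancel prime-P P∤x (subst (x ∣_) (regroup (2 ^ k) P Q) x∣n))
    where
    regroup : ∀ a P Q → a * (P * Q) ≡ P * (Q * a)
    regroup = solve-∀

  shape-1 : ∀ {x} → x ∣ n → ¬ P ∣ x → ¬ Q ∣ x → ∃[ i ] i ≤ k × x ≡ 1 * 2 ^ i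
  shape-1 {x} x∣n P∤x Q∤x = multiple∣c*2^k 1 k (1∣ x)
    (prime-cancel prime-Q Q∤x (prime-cancel prime-P P∤x (subst (x ∣_) (regroup (2 ^ k) P Q) x∣n)))
    where
    regroup : ∀ a P Q → a * (P * Q) ≡ P * (Q * (1 * a))
    regroup = solve-∀

  P∤c*2^i : ∀ {c} i → ¬ P ∣ c → ¬ P ∣ c * 2 ^ i
  P∤c*2^i i P∤c = prime∤* prime-P P∤c (P∤2^ i)

  Q∤c*2^i : ∀ {c} i → ¬ Q ∣ c → ¬ Q ∣ c * 2 ^ i
  Q∤c*2^i i Q∤c = prime∤* prime-Q Q∤c (Q∤2^ i)

  P∤Q : ¬ P ∣ Q
  P∤Q = prime∤prime prime-P prime-Q P≢Q

  Q∤P : ¬ Q ∣ P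
  Q∤P = prime∤prime prime-Q prime-P (≢-sym P≢Q)

  doubling∈divisors : ∀ c .{{_ : NonZero c}} {i} → c ∣ P * Q → i ≤ k → c * 2 ^ i ∈ divisors n
  doubling∈divisors c {i} c∣PQ i≤k =
    let instance _ = m^n≢0 2 i in
    ∈-divisors (>-nonZero⁻¹ (c * 2 ^ i) {{m*n≢0 c (2 ^ i)}})
      (subst (c * 2 ^ i ∣_) (*-comm (P * Q) (2 ^ k)) (*-pres-∣ c∣PQ (^-∣ 2 i≤k)))

  class-lower : ∀ c .{{_ : NonZero c}} L → (∀ i → i ≤ k → c * 2 ^ i ∈ L) → c * M ≤ sum L
  class-lower c L contains = +-cancelˡ-≤ c _ _ (begin
    c + c * M      ≡⟨ distrib c M ⟩
    c * (M + 1)    ≡⟨ cong (c *_) M+1≡2^[k+1] ⟩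
    c * 2 ^ suc k  ≤⟨ doublings-below c (suc k) L (λ i i<1+k → contains i (s≤s⁻¹ i<1+k)) ⟩
    c + sum L      ∎)
    where
    open ≤-Reasoning
    distrib : ∀ c M → c + c * M ≡ c * (M + 1)
    distrib = solve-∀

  σ-lower : (P * Q) * M + P * M + (Q * M + 1 * M) ≤ σ n
  σ-lower = subst (_ ≤_) (sym (sum-classes (divisors n)))
    (+-mono-≤ (+-mono-≤ lower-PQ lower-P) (+-mono-≤ lower-Q lower-1))
    where
    in-class : ∀ {A B : Pred ℕ 0ℓ} (A? : Decidable A) (B? : Decidable B) c .{{_ : NonZero c}} →
      c ∣ P * Q → (∀ i → A (c * 2 ^ i)) → (∀ i → B (c * 2 ^ i)) →
      ∀ i → i ≤ k → c * 2 ^ i ∈ filter B? (filter A? (divisors n))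
    in-class A? B? c c∣PQ a b i i≤k = ∈-filter²⁺ A? B? (doubling∈divisors c c∣PQ i≤k) (a i) (b i)
    lower-PQ : (P * Q) * M ≤ sum (byPQ (divisors n))
    lower-PQ = class-lower (P * Q) _ (in-class (P ∣?_) (Q ∣?_) (P * Q) ∣-refl
      (λ i → ∣m⇒∣m*n (2 ^ i) (m∣m*n Q)) (λ i → ∣m⇒∣m*n (2 ^ i) (n∣m*n P)))
    lower-P : P * M ≤ sum (byP (divisors n))
    lower-P = class-lower P _ (in-class (P ∣?_) Q∤? P (m∣m*n Q)
      (λ i → m∣m*n (2 ^ i)) (λ i → Q∤c*2^i i Q∤P))
    lower-Q : Q * M ≤ sum (byQ (divisors n))
    lower-Q = class-lower Q _ (in-class P∤? (Q ∣?_) Q (n∣m*n P)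
      (λ i → P∤c*2^i i P∤Q) (λ i → m∣m*n (2 ^ i)))
    lower-1 : 1 * M ≤ sum (by1 (divisors n))
    lower-1 = class-lower 1 _ (in-class P∤? Q∤? 1 (1∣ (P * Q))
      (λ i → P∤c*2^i i (prime∤1 prime-P)) (λ i → Q∤c*2^i i (prime∤1 prime-Q)))

  abundant : P * Q < M * P + (M * Q + M) → Abundant n
  abundant PQ<M[P+Q+1] = begin-strict
    2 * n                           ≡⟨ *-assoc 2 (2 ^ k) (P * Q) ⟨
    2 ^ suc k * (P * Q)             ≡⟨ cong (_* (P * Q)) M+1≡2^[k+1] ⟨
    (M + 1) * (P * Q)               ≡⟨ distrib M (P * Q) ⟩
    M * (P * Q) + P * Q             <⟨ +-monoʳ-< (M * (P * Q)) PQ<M[P+Q+1] ⟩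
    M * (P * Q) + (M * P + (M * Q + M))  ≡⟨ regroup M P Q ⟩
    (P * Q) * M + P * M + (Q * M + 1 * M) ≤⟨ σ-lower ⟩
    σ n                             ∎
    where
    open ≤-Reasoning
    distrib : ∀ M x → (M + 1) * x ≡ M * x + x
    distrib = solve-∀
    regroup : ∀ M P Q → M * (P * Q) + (M * P + (M * Q + M)) ≡ (P * Q) * M + P * M + (Q * M + 1 * M)
    regroup = solve-∀

  module AliquotSubset {xs : List ℕ} (xs⊆ : xs ⊆ aliquotParts n) where

    class-unique : ∀ {A B : Pred ℕ 0ℓ} (A? : Decidable A) (B? : Decidable B) →
      Unique (filter B? (filter A? xs))
    class-unique A? B? = filter⁺ B? (filter⁺ A? (Unique-⊆ xs⊆ (aliquotParts-unique n)))

    aliquot : ∀ {x} → x ∈ xs → x ∣ n × x < n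
    aliquot x∈xs = ∈-aliquotParts⁻ (Any-resp-⊆ xs⊆ x∈xs)

    -- Here i < k, since pq·2^k = n itself is not an aliquot part.
    shape-byPQ : ∀ {x} → x ∈ byPQ xs → DoublingOf (P * Q) k x
    shape-byPQ x∈ with ∈-filter²⁻ (P ∣?_) (Q ∣?_) x∈
    ... | x∈xs , P∣x , Q∣x with aliquot x∈xs
    ... | x∣n , x<n with shape-PQ x∣n P∣x Q∣x
    ... | i , i≤k , refl with m≤n⇒m<n∨m≡n i≤k
    ...   | inj₁ i<k  = i , i<k , refl
    ...   | inj₂ refl = ⊥-elim (<-irrefl (*-comm (P * Q) (2 ^ k)) x<n)

    shape-byP : ∀ {x} → x ∈ byP xs → DoublingOf P (suc k) x
    shape-byP x∈ with ∈-filter²⁻ (P ∣?_) Q∤? x∈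
    ... | x∈xs , P∣x , Q∤x with shape-P (proj₁ (aliquot x∈xs)) P∣x Q∤x
    ... | i , i≤k , x≡ = i , s≤s i≤k , x≡

    shape-byQ : ∀ {x} → x ∈ byQ xs → DoublingOf Q (suc k) x
    shape-byQ x∈ with ∈-filter²⁻ P∤? (Q ∣?_) x∈
    ... | x∈xs , P∤x , Q∣x with shape-Q (proj₁ (aliquot x∈xs)) P∤x Q∣x
    ... | i , i≤k , x≡ = i , s≤s i≤k , x≡

    shape-by1 : ∀ {x} → x ∈ by1 xs → DoublingOf 1 (suc k) x
    shape-by1 x∈ with ∈-filter²⁻ P∤? Q∤? x∈
    ... | x∈xs , P∤x , Q∤x with shape-1 (proj₁ (aliquot x∈xs)) P∤x Q∤x
    ... | i , i≤k , x≡ = i , s≤s i≤k , x≡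

    sum-byPQ : ∃[ A ] sum (byPQ xs) ≡ A * (P * Q) × A < 2 ^ k
    sum-byPQ = distinct-doublings-sum (P * Q) k (class-unique (P ∣?_) (Q ∣?_)) (All.tabulate shape-byPQ)

    sum-byP : ∃[ s ] sum (byP xs) ≡ s * P × s < 2 ^ suc k
    sum-byP = distinct-doublings-sum P (suc k) (class-unique (P ∣?_) Q∤?) (All.tabulate shape-byP)

    sum-byQ : ∃[ t ] sum (byQ xs) ≡ t * Q × t < 2 ^ suc k
    sum-byQ = distinct-doublings-sum Q (suc k) (class-unique P∤? (Q ∣?_)) (All.tabulate shape-byQ)

    sum-by1 : ∃[ r ] sum (by1 xs) ≡ r * 1 × r < 2 ^ suc k
    sum-by1 = distinct-doublings-sum 1 (suc k) (class-unique P∤? Q∤?) (All.tabulate shape-by1)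

  <2^[k+1]⇒≤M : ∀ {x} → x < 2 ^ suc k → x ≤ M
  <2^[k+1]⇒≤M {x} x<2^[k+1] = s≤s⁻¹ (subst (x <_) (trans (sym M+1≡2^[k+1]) (+-comm M 1)) x<2^[k+1])

  subset-sum-shape : ∀ {xs} → xs ⊆ aliquotParts n →
    ∃[ A ] ∃[ r ] ∃[ s ] ∃[ t ] A < 2 ^ k × r ≤ M × s ≤ M × t ≤ M ×
      sum xs ≡ A * (P * Q) + (r + s * P + t * Q)
  subset-sum-shape {xs} xs⊆ =
    let open AliquotSubset xs⊆
        A , sum≡A·PQ , A<2^k = sum-byPQ
        s , sum≡s·P , s<2^[k+1] = sum-byP
        t , sum≡t·Q , t<2^[k+1] = sum-byQ
        r , sum≡r·1 , r<2^[k+1] = sum-by1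
    in A , r , s , t , A<2^k , <2^[k+1]⇒≤M r<2^[k+1] , <2^[k+1]⇒≤M s<2^[k+1] , <2^[k+1]⇒≤M t<2^[k+1] ,
       (begin
      sum xs                                       ≡⟨ sum-classes xs ⟩
      (sum (byPQ xs) + sum (byP xs)) + (sum (byQ xs) + sum (by1 xs))
        ≡⟨ cong₂ _+_ (cong₂ _+_ sum≡A·PQ sum≡s·P) (cong₂ _+_ sum≡t·Q sum≡r·1) ⟩
      (A * (P * Q) + s * P) + (t * Q + r * 1)      ≡⟨ regroup A (P * Q) s P t Q r ⟩
      A * (P * Q) + (r + s * P + t * Q)            ∎)
    where
    open ≡-Reasoning
    regroup : ∀ A N s P t Q r → (A * N + s * P) + (t * Q + r * 1) ≡ A * N + (r + s * P + t * Q)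
    regroup = solve-∀

  -- A subset sum equal to n = 2^k·pq forces r + s·p + t·q = pq, which is excluded.
  not-pseudoperfect : M < P → NoSmallRepresentation M P Q → ¬ Pseudoperfect n
  not-pseudoperfect M<P no-rep (_ , xs , xs⊆ , sum≡n) =
    let A , r , s , t , A<2^k , r≤M , s≤M , t≤M , sum≡ = subset-sum-shape xs⊆
        R = r + s * P + t * Q
        n≡A·PQ+R : 2 ^ k * (P * Q) ≡ A * (P * Q) + R
        n≡A·PQ+R = trans (sym sum≡n) sum≡
    in combination-≢ prime-P prime-Q M<P P<Q no-rep r s t r≤M s≤M t≤M
         (sym (remainder-≡ {A} {2 ^ k} {P * Q} {R} A<2^k n≡A·PQ+R (combination-< M<P P<Q r≤M s≤M t≤M)))

  weird : M < P → P * Q < M * P + (M * Q + M) → NoSmallRepresentation M P Q → Weird n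
  weird M<P PQ<M[P+Q+1] no-rep = abundant PQ<M[P+Q+1] , not-pseudoperfect M<P no-rep

mainTheorem2 : (k a d e : ℕ) → 1 ≤ k →
    (2 ^ (k + 1) ∸ 1) < a → a < (2 ^ (k + 1) ∸ 1) * ((2 ^ (k + 1) ∸ 1) + 1) →
    1 ≤ d → d < e →
    4 * (d * e) + a ≡ (2 ^ (k + 1) ∸ 1) * ((2 ^ (k + 1) ∸ 1) + 1) →
    Prime ((2 ^ (k + 1) ∸ 1) + 2 * d) → Prime ((2 ^ (k + 1) ∸ 1) + 2 * e) →
    ((r s t : ℕ) → 1 ≤ r → r ≤ (2 ^ (k + 1) ∸ 1) → 1 ≤ s → s ≤ (2 ^ (k + 1) ∸ 1) → 1 ≤ t → t ≤ (2 ^ (k + 1) ∸ 1) →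
    ((2 ^ (k + 1) ∸ 1) + 2 * d) * ((2 ^ (k + 1) ∸ 1) + 2 * e) ≢ r + s * ((2 ^ (k + 1) ∸ 1) + 2 * d) + t * ((2 ^ (k + 1) ∸ 1) + 2 * e)) →
    Weird (2 ^ k * (((2 ^ (k + 1) ∸ 1) + 2 * d) * ((2 ^ (k + 1) ∸ 1) + 2 * e)))
mainTheorem2 k a d e _ M<a _ 1≤d d<e 4de+a≡M[M+1] prime-P prime-Q no-rep =
  TwoPowerTimesTwoPrimes.weird k M P Q M+1≡2^[k+1] prime-P prime-Q 2<P P<Q M<P PQ<M[P+Q+1] no-rep
  where
  M P Q : ℕ
  M = 2 ^ (k + 1) ∸ 1
  P = M + 2 * d
  Q = M + 2 * e

  M+1≡2^[k+1] : M + 1 ≡ 2 ^ suc k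
  M+1≡2^[k+1] = trans (m∸n+n≡m (m^n>0 2 (k + 1))) (cong (2 ^_) (+-comm k 1))

  2<P : 2 < P
  2<P = +-mono-≤ (+-cancelʳ-≤ 1 1 M (subst (2 ≤_) (sym M+1≡2^[k+1]) (*-monoʳ-≤ 2 (m^n>0 2 k))))
                 (*-monoʳ-≤ 2 1≤d)

  P<Q : P < Q
  P<Q = +-monoʳ-< M (*-monoʳ-< 2 d<e)

  M<P : M < P
  M<P = subst (_≤ P) (+-comm M 1) (+-monoʳ-≤ M (≤-trans 1≤d (m≤m+n d (d + 0))))

  PQ+a≡M[P+Q+1] : P * Q + a ≡ M * P + (M * Q + M)
  PQ+a≡M[P+Q+1] = +-cancelʳ-≡ (4 * (d * e)) _ _ (begin
    P * Q + a + 4 * (d * e)          ≡⟨ regroup (P * Q) a (4 * (d * e)) ⟩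
    P * Q + (4 * (d * e) + a)        ≡⟨ cong (P * Q +_) 4de+a≡M[M+1] ⟩
    P * Q + M * (M + 1)              ≡⟨ expand M d e ⟩
    M * P + (M * Q + M) + 4 * (d * e) ∎)
    where
    open ≡-Reasoning
    regroup : ∀ x a y → x + a + y ≡ x + (y + a)
    regroup = solve-∀
    expand : ∀ M d e → (M + 2 * d) * (M + 2 * e) + M * (M + 1) ≡
                       M * (M + 2 * d) + (M * (M + 2 * e) + M) + 4 * (d * e)
    expand = solve-∀

  PQ<M[P+Q+1] : P * Q < M * P + (M * Q + M)
  PQ<M[P+Q+1] = subst (P * Q <_) PQ+a≡M[P+Q+1] (m<m+n (P * Q) (≤-<-trans z≤n M<a))
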